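{- If $H$ is a hole of $G$ containing a vertex of $D$, then $H$ contains at most two vertices of $C$, and every vertex of $V(H)\cap V(C)$ is adjacent to the unique vertex of $V(H)\cap D$.
   Context: Graphs are finite and simple. A hole is an induced cycle of length at least $4$; a graph is chordal if it has no hole. Let $s_k=4k(\log k+\log\log k+4)$ for $k\ge2$, $s_1=2$, and $\mu_k=76s_{k+1}+3217k+1985$. Standing assumptions: $G$ is a graph, $k$ a positive integer, $C$ a shortest hole of $G$ of length strictly greater than $\mu_k$, and $G-V(C)$ is chordal. $D$ is the set of vertices of $G$ adjacent to every vertex of $C$ (such a hole contains exactly one vertex of $D$). -}

module Defs where

open import Data.Nat as ℕ using (ℕ; zero; suc; _+_; _*_; _!)
open import Data.Nat.Properties using (_!≢0)
open import Data.Fin using (Fin; toℕ)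
open import Data.Integer as ℤ using (ℤ; +_)
open import Data.Rational as ℚ using (ℚ; 0ℚ; 1ℚ)
open import Data.Product using (Σ; ∃; _×_; _,_)
open import Data.Sum using (_⊎_)
open import Relation.Binary.PropositionalEquality using (_≡_; _≢_)
open import Relation.Nullary using (¬_; Dec)
open import Function.Definitions using (Injective)
open import Function.Bundles using (_⇔_)

record Graph (n : ℕ) : Set₁ where
  field
    Adj     : Fin n → Fin n → Set
    adj?    : ∀ u v → Dec (Adj u v)
    sym     : ∀ {u v} → Adj u v → Adj v u
    irrefl  : ∀ {u} → ¬ Adj u u
open Graph public

-- Cycles.  A cycle of length m is given by a list of vertices
-- h 0, h 1, …, h (m-1); positions i and j are consecutive if
-- j = i + 1, or i = m - 1 and j = 0 (or symmetrically).

Next : (m : ℕ) → Fin m → Fin m → Set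
Next m i j = (suc (toℕ i) ≡ toℕ j) ⊎ ((suc (toℕ i) ≡ m) × (toℕ j ≡ 0))

Consecutive : (m : ℕ) → Fin m → Fin m → Set
Consecutive m i j = Next m i j ⊎ Next m j i

record IsHole {n : ℕ} (G : Graph n) (m : ℕ) (h : Fin m → Fin n) : Set where
  field
    length≥4 : 4 ℕ.≤ m
    distinct : Injective _≡_ _≡_ h
    induced  : ∀ i j → Adj G (h i) (h j) ⇔ Consecutive m i j

_∈V_ : ∀ {n m} → Fin n → (Fin m → Fin n) → Set
v ∈V h = ∃ λ i → h i ≡ v

-- G - S is chordal (S a set of vertices of G): G - S has no hole.
-- The holes of the induced subgraph G - S are exactly the holes of G
-- none of whose vertices lies in S.
ChordalWithout : ∀ {n} → Graph n → (Fin n → Set) → Set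
ChordalWithout {n} G S =
  ∀ m (h : Fin m → Fin n) → IsHole G m h → ¬ (∀ i → ¬ S (h i))

-- The threshold μ_k = 76 s_{k+1} + 3217 k + 1985, where
-- s_j = 4 j (log j + log log j + 4) for j ≥ 2 (natural logarithm).
-- Since k ≥ 1 we have k+1 ≥ 2, so only this branch of s is used.
--
-- There are no reals in the library, so the real inequality  L > μ_k
-- is encoded exactly via rational partial sums of the exponential series.
-- Put a = k + 1 and
--     A = (L - 3217k - 1985) / (304 a) - 4
--       = (L - 3217k - 1985 - 1216 a) / (304 a)      (a rational).
-- Then L > μ_k  ⇔  A > log a + log log a = log (a log a)
--               ⇔  a < exp (exp A / a).
-- (If this holds then A > 0, because a log a ≥ 2 log 2 > 1.)
-- For y ≥ 0 the partial sums S_N(y) = Σ_{i<N} yⁱ/i! increase to exp y,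
-- and exp is continuous and increasing, so (for A ≥ 0)
--     a < exp (exp A / a)  ⇔  ∃ N M. a < S_M (S_N(A) / a).

powℚ : ℚ → ℕ → ℚ
powℚ x zero    = 1ℚ
powℚ x (suc i) = x ℚ.* powℚ x i

expPartial : ℕ → ℚ → ℚ
expPartial zero    x = 0ℚ
expPartial (suc N) x =
  expPartial N x ℚ.+ powℚ x N ℚ.* ((+ 1) ℚ./ (N !)) {{N !≢0}}

-- A as above; 304 (k+1) = suc (303 + 304 k)
muArg : (k L : ℕ) → ℚ
muArg k L =
  (+ L ℤ.- (+ (3217 * k + 1985 + 1216 * suc k))) ℚ./ suc (303 + 304 * k)

-- L > μ_k  (for k ≥ 1)
ExceedsMu : (k L : ℕ) → Set
ExceedsMu k L =
  (0ℚ ℚ.≤ muArg k L) ×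
  ∃ λ N → ∃ λ M →
    ((+ suc k) ℚ./ 1) ℚ.< expPartial M (expPartial N (muArg k L) ℚ.* ((+ 1) ℚ./ suc k))

{-# OPTIONS --safe #-}
-- A vertex of D on H is adjacent to every vertex of C, so every vertex of C on H
-- is a neighbour of it; as H is induced, its neighbours are its two cycle
-- neighbours.
module Submission where

open import Defs
open import Data.Nat using (ℕ; _≤_)
open import Data.Nat.Properties using (suc-injective; <⇒≢)
open import Data.Fin using (Fin; toℕ)
open import Data.Fin.Properties using (toℕ-injective; toℕ<n)
open import Data.Product using (∃; _×_; _,_)
open import Data.Sum using (inj₁; inj₂)
open import Data.Empty using (⊥; ⊥-elim)
open import Relation.Binary.PropositionalEquality
  using (_≡_; _≢_; refl; trans) renaming (sym to ≡-sym)
open import Function.Bundles using (Equivalence)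

Next-functional : ∀ {m} {i j j′ : Fin m} → Next m i j → Next m i j′ → j ≡ j′
Next-functional (inj₁ p) (inj₁ q) = toℕ-injective (trans (≡-sym p) q)
Next-functional {j = j} (inj₁ p) (inj₂ (q , _)) =
  ⊥-elim (<⇒≢ (toℕ<n j) (trans (≡-sym p) q))
Next-functional {j′ = j′} (inj₂ (p , _)) (inj₁ q) =
  ⊥-elim (<⇒≢ (toℕ<n j′) (trans (≡-sym q) p))
Next-functional (inj₂ (_ , p)) (inj₂ (_ , q)) = toℕ-injective (trans p (≡-sym q))

Next-injective : ∀ {m} {i i′ j : Fin m} → Next m i j → Next m i′ j → i ≡ i′
Next-injective (inj₁ p) (inj₁ q) =
  toℕ-injective (suc-injective (trans p (≡-sym q)))
Next-injective (inj₁ p) (inj₂ (_ , q)) with trans p q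
... | ()
Next-injective (inj₂ (_ , p)) (inj₁ q) with trans q p
... | ()
Next-injective (inj₂ (p , _)) (inj₂ (q , _)) =
  toℕ-injective (suc-injective (trans p (≡-sym q)))

-- Two of the three positions lie on the same side of i.
Consecutive-atMostTwo : ∀ {m} {i j₁ j₂ j₃ : Fin m} → j₁ ≢ j₂ → j₁ ≢ j₃ → j₂ ≢ j₃ →
  Consecutive m i j₁ → Consecutive m i j₂ → Consecutive m i j₃ → ⊥
Consecutive-atMostTwo ≢₁₂ _ _ (inj₁ n₁) (inj₁ n₂) _ = ≢₁₂ (Next-functional n₁ n₂)
Consecutive-atMostTwo ≢₁₂ _ _ (inj₂ n₁) (inj₂ n₂) _ = ≢₁₂ (Next-injective n₁ n₂)
Consecutive-atMostTwo _ ≢₁₃ _ (inj₁ n₁) (inj₂ _) (inj₁ n₃) = ≢₁₃ (Next-functional n₁ n₃)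
Consecutive-atMostTwo _ _ ≢₂₃ (inj₁ _) (inj₂ n₂) (inj₂ n₃) = ≢₂₃ (Next-injective n₂ n₃)
Consecutive-atMostTwo _ _ ≢₂₃ (inj₂ _) (inj₁ n₂) (inj₁ n₃) = ≢₂₃ (Next-functional n₂ n₃)
Consecutive-atMostTwo _ ≢₁₃ _ (inj₂ n₁) (inj₁ _) (inj₂ n₃) = ≢₁₃ (Next-injective n₁ n₃)

hole-noThreeNeighbours : ∀ {n m} {G : Graph n} {h : Fin m → Fin n} → IsHole G m h →
  ∀ {i j₁ j₂ j₃} → j₁ ≢ j₂ → j₁ ≢ j₃ → j₂ ≢ j₃ →
  Adj G (h i) (h j₁) → Adj G (h i) (h j₂) → Adj G (h i) (h j₃) → ⊥
hole-noThreeNeighbours {G = G} {h = h} hole {i} ≢₁₂ ≢₁₃ ≢₂₃ a₁ a₂ a₃ =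
  Consecutive-atMostTwo ≢₁₂ ≢₁₃ ≢₂₃ (consecutive a₁) (consecutive a₂) (consecutive a₃)
  where
  consecutive : ∀ {j} → Adj G (h i) (h j) → Consecutive _ i j
  consecutive {j} = Equivalence.to (IsHole.induced hole i j)

complete-adj-∈V : ∀ {n m} (G : Graph n) {c : Fin m → Fin n} {v w} →
  (∀ l → Adj G v (c l)) → w ∈V c → Adj G v w
complete-adj-∈V _ complete (l , refl) = complete l

lemma4p9 : ∀ {n : ℕ} (G : Graph n) (k : ℕ) → 1 ≤ k →
    ∀ (L : ℕ) (c : Fin L → Fin n) →
    IsHole G L c →
    (∀ (m : ℕ) (h : Fin m → Fin n) → IsHole G m h → L ≤ m) →
    ExceedsMu k L →
    ChordalWithout G (λ v → v ∈V c) →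
    ∀ (m : ℕ) (h : Fin m → Fin n) → IsHole G m h →
    (∃ λ i → ∀ (j : Fin L) → Adj G (h i) (c j)) →
    (∀ (i₁ i₂ i₃ : Fin m) → i₁ ≢ i₂ → i₁ ≢ i₃ → i₂ ≢ i₃ →
       h i₁ ∈V c → h i₂ ∈V c → h i₃ ∈V c → ⊥)
    × (∀ (i j : Fin m) → (∀ (l : Fin L) → Adj G (h i) (c l)) →
       h j ∈V c → Adj G (h j) (h i))
lemma4p9 G _ _ L c _ _ _ _ m h hole (i₀ , complete) = atMostTwo , adjacent
  where
  atMostTwo : ∀ (i₁ i₂ i₃ : Fin m) → i₁ ≢ i₂ → i₁ ≢ i₃ → i₂ ≢ i₃ →
              h i₁ ∈V c → h i₂ ∈V c → h i₃ ∈V c → ⊥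
  atMostTwo _ _ _ ≢₁₂ ≢₁₃ ≢₂₃ x₁ x₂ x₃ =
    hole-noThreeNeighbours hole {i₀} ≢₁₂ ≢₁₃ ≢₂₃
      (adj₀ x₁) (adj₀ x₂) (adj₀ x₃)
    where
    adj₀ : ∀ {w} → w ∈V c → Adj G (h i₀) w
    adj₀ = complete-adj-∈V G complete

  adjacent : ∀ (i j : Fin m) → (∀ (l : Fin L) → Adj G (h i) (c l)) →
             h j ∈V c → Adj G (h j) (h i)
  adjacent _ _ completeᵢ x = Graph.sym G (complete-adj-∈V G completeᵢ x)
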